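{- Let $\Gamma=\Gamma_0(2)$ and let $c$ be the complex conjugation $c(z)=1/(2\bar z)$ of the upper half-plane. Then $\Gamma$ has a single twisted conjugacy class of admissible elements (with respect to $c$), and it is of Type 4b.
   Context: $\Gamma_0(2)$ is the image in $\mathrm{PSL}_2(\mathbf{Z})$ of integer matrices of determinant 1 with even lower-left entry; $(\Gamma,c)$ is a real Fuchsian group. $\gamma^c=c\gamma c$; $\gamma$ is admissible if $\gamma^c=\gamma^{ -1}$; $\gamma,\gamma'$ are twisted conjugate if $\gamma=\delta^c\gamma'\delta^{ -1}$ for some $\delta\in\Gamma$. For admissible $\gamma$ let $C_\gamma=\{z\in\mathfrak{h}\cup\mathbf{Q}\mathbf{P}^1:\gamma z=cz\}$ and $Z_\gamma=\{\sigma\in\Gamma:\sigma^c\gamma\sigma^{ -1}=\gamma\}$. $\gamma$ is of Type 4 if $Z_\gamma$ is infinite dihedral; then $C_\gamma/Z_\gamma$ is a closed interval whose two endpoints are images of elliptic points of even order, and $\gamma$ is of Type 4b if these two elliptic points are equivalent under $\Gamma$ (Type 4a otherwise). -}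

module Defs where

open import Data.Integer using (ℤ; +_; _+_; _-_; _*_; -_)
open import Data.Nat using (ℕ; zero; suc)
open import Data.Product using (Σ; _×_; _,_)
open import Data.Sum using (_⊎_)
open import Relation.Binary.PropositionalEquality using (_≡_)
open import Relation.Nullary using (¬_)

-- An integer 2x2 matrix  [[a , b] , [2k , d]]  whose lower-left entry is
-- even, recorded through k (lower-left entry = 2 * k).
record Mat : Set where
  constructor mat
  field
    a b k d : ℤ
open Mat public

ll : Mat → ℤ
ll m = + 2 * k m

det : Mat → ℤ
det m = a m * d m - b m * ll m

-- Membership in the group Γ₀(2): integer matrices of determinant 1 with
-- even lower-left entry (evenness is built into the representation).
InΓ : Mat → Set
InΓ m = det m ≡ + 1

-- Equality in PSL₂: equal as matrices or equal up to the sign ±1.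
_≈_ : Mat → Mat → Set
m ≈ n = (a m ≡ a n × b m ≡ b n × k m ≡ k n × d m ≡ d n)
      ⊎ (a m ≡ - a n × b m ≡ - b n × k m ≡ - k n × d m ≡ - d n)
infix 4 _≈_

I : Mat
I = mat (+ 1) (+ 0) (+ 0) (+ 1)

-- matrix product (lower-left entry of the product is 2(k a' + d k'))
_·_ : Mat → Mat → Mat
m · n = mat (a m * a n + b m * ll n)
            (a m * b n + b m * d n)
            (k m * a n + d m * k n)
            (ll m * b n + d m * d n)
infixl 7 _·_

inv : Mat → Mat
inv m = mat (d m) (- b m) (- k m) (a m)

-- The twist γ ↦ γᶜ = c γ c for c(z) = 1/(2 z̄).  Writing c(z) = M·z̄ with
-- M = [[0,1],[2,0]] and γ real, cγc = M γ M⁻¹, which for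
-- γ = [[a,b],[2k,d]] equals [[d , k] , [2b , a]].
twist : Mat → Mat
twist m = mat (d m) (k m) (b m) (a m)

Admissible : Mat → Set
Admissible γ = twist γ ≈ inv γ

TwistedConj : Mat → Mat → Set
TwistedConj γ γ' = Σ Mat λ δ → InΓ δ × (γ ≈ twist δ · γ' · inv δ)

InZ : Mat → Mat → Set
InZ γ σ = InΓ σ × (twist σ · γ · inv σ ≈ γ)

_^_ : Mat → ℕ → Mat
m ^ zero = I
m ^ suc n = m · (m ^ n)

Involution : Mat → Set
Involution s = (s · s ≈ I) × ¬ (s ≈ I)

InfDihedralPair : Mat → Mat → Set
InfDihedralPair s t =
  Involution s × Involution t × ((n : ℕ) → ¬ ((s · t) ^ suc n ≈ I))

Generated : Mat → Mat → Mat → Set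
Generated s t σ = Σ ℕ λ n →
  (σ ≈ (s · t) ^ n) ⊎ (σ ≈ (t · s) ^ n) ⊎
  (σ ≈ (s · t) ^ n · s) ⊎ (σ ≈ (t · s) ^ n · t)

-- Type 4 with the two endpoint elliptic points Γ-equivalent (Type 4b):
-- Z_γ is infinite dihedral, generated by two involutions s, t (the
-- reflections of the geodesic C_γ in the two endpoints of C_γ/Z_γ,
-- i.e. the stabilisers of the two endpoint elliptic points of order 2),
-- and these are conjugate in Γ (equivalently, their fixed points — the
-- endpoints — are Γ-equivalent).
Type4b : Mat → Set
Type4b γ = Σ Mat λ s → Σ Mat λ t →
  InZ γ s × InZ γ t × InfDihedralPair s t ×
  ((σ : Mat) → InZ γ σ → Generated s t σ) ×
  (Σ Mat λ g → InΓ g × (g · s · inv g ≈ t))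

-- An admissible element of Γ₀(2) is a matrix [[p, q], [−2q, r]] with pr + 2q² = 1 (the other
-- branch of γᶜ = ±γ⁻¹ would force det γ = −2q²). Twisted conjugation by [[1, ±1], [0, 1]] or
-- [[1, 0], [±2, 1]] replaces q by q ∓ p or q ± r; as |p||r| ≤ 1 + 2q² < 4q² when q ≠ 0, one of
-- |p|, |r| is below 2|q| and one of these moves decreases |q|, until q = 0 and pr = 1 gives ±I.
-- Twisted conjugation by δ turns the twisted centraliser of I into that of δᶜδ⁻¹ by conjugation
-- with δ, so it remains to describe Z_I = {σ : σᶜ = ±σ}. Up to a factor s₀ its elements are the
-- matrices [[x, y], [2y, x]] with x² − 2y² = 1, and the Pell descent (x, y) ↦ (3x − 4y, 3y − 2x)
-- exhibits them as the powers of s₀t₀ and t₀s₀ = ±[[3, 2], [4, 3]]; so Z_I is the infinite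
-- dihedral group generated by the half-turns s₀, t₀, which are conjugate by z ↦ z + 1.

{-# OPTIONS --safe #-}
module Submission where

open import Defs
open import Data.Empty using (⊥; ⊥-elim)
open import Data.List using (_∷_; [])
open import Data.Nat as ℕ using (ℕ; zero; suc; _<_; _≤_; z≤n; s≤s; _<?_)
open import Data.Nat.Induction using (<-rec)
import Data.Nat.Properties as ℕ
open import Data.Nat.Tactic.RingSolver using (solve)
open import Data.Product using (Σ; _×_; _,_; proj₁; proj₂)
open import Data.Sum using (_⊎_; inj₁; inj₂)
open import Relation.Binary.Bundles using (Setoid)
open import Relation.Binary.PropositionalEquality
import Relation.Binary.Reasoning.Setoid
open import Relation.Nullary using (¬_; yes; no)

module Pell where
  open import Data.Nat using (_+_; _*_; _∸_; >-nonZero)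
  open import Data.Nat.Properties

  pell-step : ℕ × ℕ → ℕ × ℕ
  pell-step (x , y) = 3 * x + 4 * y , 2 * x + 3 * y

  pell : ℕ → ℕ × ℕ
  pell zero    = 1 , 0
  pell (suc n) = pell-step (pell n)

  PellSolution : ℕ → ℕ → Set
  PellSolution x y = x * x ≡ 1 + 2 * (y * y)

  x*x≢3 : ∀ x → x * x ≢ 3
  x*x≢3 zero          ()
  x*x≢3 (suc zero)    ()
  x*x≢3 (suc (suc x)) e = 4≰3 (subst (4 ≤_) e (*-mono-≤ 2≤x 2≤x))
    where
    2≤x : 2 ≤ suc (suc x)
    2≤x = s≤s (s≤s z≤n)
    4≰3 : ¬ 4 ≤ 3
    4≰3 (s≤s (s≤s (s≤s ())))

  pell-step-inverse : ∀ x y x′ y′ → 4 * y + x′ ≡ 3 * x → 2 * x + y′ ≡ 3 * y → pell-step (x′ , y′) ≡ (x , y)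
  pell-step-inverse x y x′ y′ A B = cong₂ _,_
    (+-cancelʳ-≡ (8 * x + 12 * y) _ _ (begin
      3 * x′ + 4 * y′ + (8 * x + 12 * y)  ≡⟨ solve (x ∷ y ∷ x′ ∷ y′ ∷ []) ⟩
      3 * (4 * y + x′) + 4 * (2 * x + y′) ≡⟨ cong₂ (λ u v → 3 * u + 4 * v) A B ⟩
      3 * (3 * x) + 4 * (3 * y)           ≡⟨ solve (x ∷ y ∷ []) ⟩
      x + (8 * x + 12 * y)                ∎))
    (+-cancelʳ-≡ (6 * x + 8 * y) _ _ (begin
      2 * x′ + 3 * y′ + (6 * x + 8 * y)   ≡⟨ solve (x ∷ y ∷ x′ ∷ y′ ∷ []) ⟩
      2 * (4 * y + x′) + 3 * (2 * x + y′) ≡⟨ cong₂ (λ u v → 2 * u + 3 * v) A B ⟩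
      2 * (3 * x) + 3 * (3 * y)           ≡⟨ solve (x ∷ y ∷ []) ⟩
      y + (6 * x + 8 * y)                 ∎))
    where open ≡-Reasoning

  -- (3x + 4y)² − 2(2x + 3y)² = x² − 2y², written without subtraction.
  PellSolution-pell-step⁻¹ : ∀ x y → PellSolution (3 * x + 4 * y) (2 * x + 3 * y) → PellSolution x y
  PellSolution-pell-step⁻¹ x y E = +-cancelʳ-≡ (2 * ((2 * x + 3 * y) * (2 * x + 3 * y))) _ _ (begin
    x * x + 2 * ((2 * x + 3 * y) * (2 * x + 3 * y))         ≡⟨ solve (x ∷ y ∷ []) ⟩
    (3 * x + 4 * y) * (3 * x + 4 * y) + 2 * (y * y)          ≡⟨ cong (_+ 2 * (y * y)) E ⟩
    1 + 2 * ((2 * x + 3 * y) * (2 * x + 3 * y)) + 2 * (y * y) ≡⟨ solve (x ∷ y ∷ []) ⟩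
    1 + 2 * (y * y) + 2 * ((2 * x + 3 * y) * (2 * x + 3 * y)) ∎)
    where open ≡-Reasoning

  PellSolution⇒y<x : ∀ x y → PellSolution x y → y < x
  PellSolution⇒y<x x y E = ≰⇒> λ x≤y → <⇒≱ yy<1+2yy (subst (_≤ y * y) E (*-mono-≤ x≤y x≤y))
    where
    yy<1+2yy : y * y < 1 + 2 * (y * y)
    yy<1+2yy = s≤s (m≤m+n (y * y) (y * y + 0))

  PellSolution⇒4y≤3x : ∀ x y → PellSolution x y → 4 * y ≤ 3 * x
  PellSolution⇒4y≤3x x y E = ≮⇒≥ λ 3x<4y → <⇒≱ (*-mono-< 3x<4y 3x<4y) (begin
    (4 * y) * (4 * y)          ≡⟨ solve (y ∷ []) ⟩
    16 * (y * y)               ≤⟨ m≤n+m (16 * (y * y)) (9 + 2 * (y * y)) ⟩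
    9 + 2 * (y * y) + 16 * (y * y) ≡⟨ solve (y ∷ []) ⟩
    9 * (1 + 2 * (y * y))      ≡⟨ cong (9 *_) E ⟨
    9 * (x * x)                ≡⟨ solve (x ∷ []) ⟩
    (3 * x) * (3 * x)          ∎)
    where open ≤-Reasoning

  PellSolution⇒2x≤3y : ∀ x y → 2 ≤ y → PellSolution x y → 2 * x ≤ 3 * y
  PellSolution⇒2x≤3y x y 2≤y E = ≮⇒≥ λ 3y<2x → <⇒≱ (*-mono-< 3y<2x 3y<2x) (begin
    (2 * x) * (2 * x)          ≡⟨ solve (x ∷ []) ⟩
    4 * (x * x)                ≡⟨ cong (4 *_) E ⟩
    4 * (1 + 2 * (y * y))      ≡⟨ solve (y ∷ []) ⟩
    4 + 8 * (y * y)            ≤⟨ +-monoˡ-≤ (8 * (y * y)) (*-mono-≤ 2≤y 2≤y) ⟩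
    y * y + 8 * (y * y)        ≡⟨ solve (y ∷ []) ⟩
    (3 * y) * (3 * y)          ∎)
    where open ≤-Reasoning

  PellSolution⇒3y∸2x<y : ∀ x y → 0 < y → PellSolution x y → 3 * y ∸ 2 * x < y
  PellSolution⇒3y∸2x<y x y 0<y E = m<n+o⇒m∸n<o (3 * y) (2 * x) {{>-nonZero 0<y}} (begin-strict
    3 * y     ≡⟨ solve (y ∷ []) ⟩
    2 * y + y <⟨ +-monoˡ-< y (*-monoʳ-< 2 (PellSolution⇒y<x x y E)) ⟩
    2 * x + y ∎)
    where open ≤-Reasoning

  record PellPredecessor (x y : ℕ) : Set where
    field
      x′ y′    : ℕ
      solution : PellSolution x′ y′
      smaller  : y′ < y
      steps    : pell-step (x′ , y′) ≡ (x , y)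

  pell-predecessor : ∀ x y → 0 < y → PellSolution x y → PellPredecessor x y
  pell-predecessor x (suc zero)       _ E = ⊥-elim (x*x≢3 x E)
  pell-predecessor x y@(suc (suc _))  _ E = record
    { x′ = x′ ; y′ = y′ ; solution = solution ; smaller = smaller ; steps = steps }
    where
    x′ = 3 * x ∸ 4 * y
    y′ = 3 * y ∸ 2 * x
    2x≤3y : 2 * x ≤ 3 * y
    2x≤3y = PellSolution⇒2x≤3y x y (s≤s (s≤s z≤n)) E
    steps : pell-step (x′ , y′) ≡ (x , y)
    steps = pell-step-inverse x y x′ y′ (m+[n∸m]≡n (PellSolution⇒4y≤3x x y E)) (m+[n∸m]≡n 2x≤3y)
    solution : PellSolution x′ y′
    solution = PellSolution-pell-step⁻¹ x′ y′ (subst (λ p → PellSolution (proj₁ p) (proj₂ p)) (sym steps) E)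
    smaller : y′ < y
    smaller = PellSolution⇒3y∸2x<y x y (s≤s z≤n) E

  pell-complete : ∀ x y → PellSolution x y → Σ ℕ λ n → pell n ≡ (x , y)
  pell-complete x y = <-rec Goal descend y x
    where
    Goal : ℕ → Set
    Goal y = ∀ x → PellSolution x y → Σ ℕ λ n → pell n ≡ (x , y)
    descend : ∀ y → (∀ {y′} → y′ < y → Goal y′) → Goal y
    descend zero _ x E rewrite m*n≡1⇒m≡1 x x E = 0 , refl
    descend y@(suc _) rec x E =
      let n , pell-n = rec smaller x′ solution in suc n , trans (cong pell-step pell-n) steps
      where open PellPredecessor (pell-predecessor x y (s≤s z≤n) E)

  pell-fst-positive : ∀ n → 0 < proj₁ (pell n)
  pell-fst-positive zero    = s≤s z≤n
  pell-fst-positive (suc n) =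
    <-≤-trans (pell-fst-positive n) (≤-trans (m≤m+n x (2 * x)) (m≤m+n (3 * x) (4 * y)))
    where
    x = proj₁ (pell n)
    y = proj₂ (pell n)

  pell-snd-positive : ∀ n → 0 < proj₂ (pell (suc n))
  pell-snd-positive n =
    <-≤-trans (pell-fst-positive n) (≤-trans (m≤m+n x (x + 0)) (m≤m+n (2 * x) (3 * y)))
    where
    x = proj₁ (pell n)
    y = proj₂ (pell n)

open Pell

open import Data.Integer using (ℤ; +_; -[1+_]; +[1+_]; _+_; _-_; _*_; -_; ∣_∣; _⊖_)
import Data.Integer.Properties as ℤ
open import Data.Integer.Tactic.RingSolver using (solve-∀)

mat-≡ : ∀ {a₁ b₁ k₁ d₁ a₂ b₂ k₂ d₂ : ℤ} →
        a₁ ≡ a₂ → b₁ ≡ b₂ → k₁ ≡ k₂ → d₁ ≡ d₂ → mat a₁ b₁ k₁ d₁ ≡ mat a₂ b₂ k₂ d₂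
mat-≡ refl refl refl refl = refl

neg : Mat → Mat
neg (mat a b k d) = mat (- a) (- b) (- k) (- d)

scalar : ℤ → Mat
scalar c = mat c (+ 0) (+ 0) c

·-assoc : ∀ x y z → (x · y) · z ≡ x · (y · z)
·-assoc (mat a₁ b₁ k₁ d₁) (mat a₂ b₂ k₂ d₂) (mat a₃ b₃ k₃ d₃) =
  mat-≡ (a-entry a₁ b₁ a₂ b₂ k₂ d₂ a₃ k₃) (b-entry a₁ b₁ a₂ b₂ k₂ d₂ b₃ d₃)
        (k-entry k₁ d₁ a₂ b₂ k₂ d₂ a₃ k₃) (d-entry k₁ d₁ a₂ b₂ k₂ d₂ b₃ d₃)
  where
  a-entry : ∀ a₁ b₁ a₂ b₂ k₂ d₂ a₃ k₃ →
            (a₁ * a₂ + b₁ * (+ 2 * k₂)) * a₃ + (a₁ * b₂ + b₁ * d₂) * (+ 2 * k₃)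
            ≡ a₁ * (a₂ * a₃ + b₂ * (+ 2 * k₃)) + b₁ * (+ 2 * (k₂ * a₃ + d₂ * k₃))
  a-entry = solve-∀
  b-entry : ∀ a₁ b₁ a₂ b₂ k₂ d₂ b₃ d₃ →
            (a₁ * a₂ + b₁ * (+ 2 * k₂)) * b₃ + (a₁ * b₂ + b₁ * d₂) * d₃
            ≡ a₁ * (a₂ * b₃ + b₂ * d₃) + b₁ * (+ 2 * k₂ * b₃ + d₂ * d₃)
  b-entry = solve-∀
  k-entry : ∀ k₁ d₁ a₂ b₂ k₂ d₂ a₃ k₃ →
            (k₁ * a₂ + d₁ * k₂) * a₃ + (+ 2 * k₁ * b₂ + d₁ * d₂) * k₃
            ≡ k₁ * (a₂ * a₃ + b₂ * (+ 2 * k₃)) + d₁ * (k₂ * a₃ + d₂ * k₃)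
  k-entry = solve-∀
  d-entry : ∀ k₁ d₁ a₂ b₂ k₂ d₂ b₃ d₃ →
            + 2 * (k₁ * a₂ + d₁ * k₂) * b₃ + (+ 2 * k₁ * b₂ + d₁ * d₂) * d₃
            ≡ + 2 * k₁ * (a₂ * b₃ + b₂ * d₃) + d₁ * (+ 2 * k₂ * b₃ + d₂ * d₃)
  d-entry = solve-∀

·-identityˡ : ∀ x → I · x ≡ x
·-identityˡ (mat a b k d) =
  mat-≡ (unit-first a (+ 2 * k)) (unit-first b d) (unit-second k a) (unit-second d b)
  where
  unit-first : ∀ x y → + 1 * x + + 0 * y ≡ x
  unit-first = solve-∀
  unit-second : ∀ x y → + 0 * y + + 1 * x ≡ x
  unit-second = solve-∀

·-identityʳ : ∀ x → x · I ≡ x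
·-identityʳ (mat a b k d) =
  mat-≡ (unit-first a b) (unit-second b a) (unit-first k d) (unit-second d (+ 2 * k))
  where
  unit-first : ∀ x y → x * + 1 + y * + 0 ≡ x
  unit-first = solve-∀
  unit-second : ∀ x y → y * + 0 + x * + 1 ≡ x
  unit-second = solve-∀

inv-·-self : ∀ x → inv x · x ≡ scalar (det x)
inv-·-self (mat a b k d) =
  mat-≡ (diagonal-a a b k d) (off-diagonal-b b d) (off-diagonal-k a k) (diagonal-d a b k d)
  where
  diagonal-a : ∀ a b k d → d * a + - b * (+ 2 * k) ≡ a * d - b * (+ 2 * k)
  diagonal-a = solve-∀
  diagonal-d : ∀ a b k d → + 2 * - k * b + a * d ≡ a * d - b * (+ 2 * k)
  diagonal-d = solve-∀
  off-diagonal-b : ∀ b d → d * b + - b * d ≡ + 0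
  off-diagonal-b = solve-∀
  off-diagonal-k : ∀ a k → - k * a + a * k ≡ + 0
  off-diagonal-k = solve-∀

inv-involutive : ∀ x → inv (inv x) ≡ x
inv-involutive (mat a b k d) = mat-≡ refl (ℤ.neg-involutive b) (ℤ.neg-involutive k) refl

neg-involutive : ∀ x → neg (neg x) ≡ x
neg-involutive (mat a b k d) =
  mat-≡ (ℤ.neg-involutive a) (ℤ.neg-involutive b) (ℤ.neg-involutive k) (ℤ.neg-involutive d)

neg-distribˡ-· : ∀ x y → neg x · y ≡ neg (x · y)
neg-distribˡ-· (mat a₁ b₁ k₁ d₁) (mat a₂ b₂ k₂ d₂) =
  mat-≡ (neg-sum a₁ a₂ b₁ (+ 2 * k₂)) (neg-sum a₁ b₂ b₁ d₂) (neg-sum k₁ a₂ d₁ k₂) (d-entry k₁ b₂ d₁ d₂)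
  where
  neg-sum : ∀ w x y z → - w * x + - y * z ≡ - (w * x + y * z)
  neg-sum = solve-∀
  d-entry : ∀ k₁ b₂ d₁ d₂ → + 2 * - k₁ * b₂ + - d₁ * d₂ ≡ - (+ 2 * k₁ * b₂ + d₁ * d₂)
  d-entry = solve-∀

neg-distribʳ-· : ∀ x y → x · neg y ≡ neg (x · y)
neg-distribʳ-· (mat a₁ b₁ k₁ d₁) (mat a₂ b₂ k₂ d₂) =
  mat-≡ (a-entry a₁ a₂ b₁ k₂) (sum-neg a₁ b₂ b₁ d₂) (sum-neg k₁ a₂ d₁ k₂) (sum-neg (+ 2 * k₁) b₂ d₁ d₂)
  where
  sum-neg : ∀ w x y z → w * - x + y * - z ≡ - (w * x + y * z)
  sum-neg = solve-∀
  a-entry : ∀ a₁ a₂ b₁ k₂ → a₁ * - a₂ + b₁ * (+ 2 * - k₂) ≡ - (a₁ * a₂ + b₁ * (+ 2 * k₂))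
  a-entry = solve-∀

twist-· : ∀ x y → twist (x · y) ≡ twist x · twist y
twist-· (mat a₁ b₁ k₁ d₁) (mat a₂ b₂ k₂ d₂) =
  mat-≡ (a-entry k₁ b₂ d₁ d₂) (swap (k₁ * a₂) (d₁ * k₂)) (swap (a₁ * b₂) (b₁ * d₂)) (d-entry a₁ a₂ b₁ k₂)
  where
  swap : ∀ x y → x + y ≡ y + x
  swap = ℤ.+-comm
  a-entry : ∀ k₁ b₂ d₁ d₂ → + 2 * k₁ * b₂ + d₁ * d₂ ≡ d₁ * d₂ + k₁ * (+ 2 * b₂)
  a-entry = solve-∀
  d-entry : ∀ a₁ a₂ b₁ k₂ → a₁ * a₂ + b₁ * (+ 2 * k₂) ≡ + 2 * b₁ * k₂ + a₁ * a₂
  d-entry = solve-∀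

inv-anti-· : ∀ x y → inv (x · y) ≡ inv y · inv x
inv-anti-· (mat a₁ b₁ k₁ d₁) (mat a₂ b₂ k₂ d₂) =
  mat-≡ (a-entry k₁ b₂ d₁ d₂) (b-entry a₁ b₁ b₂ d₂) (k-entry k₁ d₁ a₂ k₂) (d-entry a₁ b₁ a₂ k₂)
  where
  a-entry : ∀ k₁ b₂ d₁ d₂ → + 2 * k₁ * b₂ + d₁ * d₂ ≡ d₂ * d₁ + - b₂ * (+ 2 * - k₁)
  a-entry = solve-∀
  b-entry : ∀ a₁ b₁ b₂ d₂ → - (a₁ * b₂ + b₁ * d₂) ≡ d₂ * - b₁ + - b₂ * a₁
  b-entry = solve-∀
  k-entry : ∀ k₁ d₁ a₂ k₂ → - (k₁ * a₂ + d₁ * k₂) ≡ - k₂ * d₁ + a₂ * - k₁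
  k-entry = solve-∀
  d-entry : ∀ a₁ b₁ a₂ k₂ → a₁ * a₂ + b₁ * (+ 2 * k₂) ≡ + 2 * - k₂ * - b₁ + a₂ * a₁
  d-entry = solve-∀

det-· : ∀ x y → det (x · y) ≡ det x * det y
det-· (mat a₁ b₁ k₁ d₁) (mat a₂ b₂ k₂ d₂) = multiplicative a₁ b₁ k₁ d₁ a₂ b₂ k₂ d₂
  where
  multiplicative : ∀ a₁ b₁ k₁ d₁ a₂ b₂ k₂ d₂ →
    (a₁ * a₂ + b₁ * (+ 2 * k₂)) * (+ 2 * k₁ * b₂ + d₁ * d₂) - (a₁ * b₂ + b₁ * d₂) * (+ 2 * (k₁ * a₂ + d₁ * k₂))
    ≡ (a₁ * d₁ - b₁ * (+ 2 * k₁)) * (a₂ * d₂ - b₂ * (+ 2 * k₂))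
  multiplicative = solve-∀

det-inv : ∀ x → det (inv x) ≡ det x
det-inv (mat a b k d) = adjugate a b k d
  where
  adjugate : ∀ a b k d → d * a - - b * (+ 2 * - k) ≡ a * d - b * (+ 2 * k)
  adjugate = solve-∀

det-twist : ∀ x → det (twist x) ≡ det x
det-twist (mat a b k d) = transpose a b k d
  where
  transpose : ∀ a b k d → d * a - k * (+ 2 * b) ≡ a * d - b * (+ 2 * k)
  transpose = solve-∀

≡⇒≈ : ∀ {x y} → x ≡ y → x ≈ y
≡⇒≈ refl = inj₁ (refl , refl , refl , refl)

≡neg⇒≈ : ∀ {x y} → x ≡ neg y → x ≈ y
≡neg⇒≈ refl = inj₂ (refl , refl , refl , refl)

≈⇒≡⊎≡neg : ∀ {x y} → x ≈ y → x ≡ y ⊎ x ≡ neg y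
≈⇒≡⊎≡neg (inj₁ (p , q , r , s)) = inj₁ (mat-≡ p q r s)
≈⇒≡⊎≡neg (inj₂ (p , q , r , s)) = inj₂ (mat-≡ p q r s)

≈-refl : ∀ {x} → x ≈ x
≈-refl = ≡⇒≈ refl

≈-sym : ∀ {x y} → x ≈ y → y ≈ x
≈-sym {y = y} e with ≈⇒≡⊎≡neg e
... | inj₁ refl = ≈-refl
... | inj₂ refl = ≡neg⇒≈ (sym (neg-involutive y))

≈-trans : ∀ {x y z} → x ≈ y → y ≈ z → x ≈ z
≈-trans {z = z} e₁ e₂ with ≈⇒≡⊎≡neg e₁ | ≈⇒≡⊎≡neg e₂
... | inj₁ refl | inj₁ refl = ≈-refl
... | inj₁ refl | inj₂ refl = ≡neg⇒≈ refl
... | inj₂ refl | inj₁ refl = ≡neg⇒≈ refl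
... | inj₂ refl | inj₂ refl = ≡⇒≈ (neg-involutive z)

≈-setoid : Setoid _ _
≈-setoid = record
  { Carrier = Mat
  ; _≈_ = _≈_
  ; isEquivalence = record { refl = ≈-refl ; sym = ≈-sym ; trans = ≈-trans }
  }

module ≈-Reasoning = Relation.Binary.Reasoning.Setoid ≈-setoid

·-congʳ : ∀ {x y} z → x ≈ y → x · z ≈ y · z
·-congʳ {y = y} z e with ≈⇒≡⊎≡neg e
... | inj₁ refl = ≈-refl
... | inj₂ refl = ≡neg⇒≈ (neg-distribˡ-· y z)

·-congˡ : ∀ {x y} z → x ≈ y → z · x ≈ z · y
·-congˡ {y = y} z e with ≈⇒≡⊎≡neg e
... | inj₁ refl = ≈-refl
... | inj₂ refl = ≡neg⇒≈ (neg-distribʳ-· z y)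

^-cong : ∀ {x y} n → x ≈ y → x ^ n ≈ y ^ n
^-cong zero e = ≈-refl
^-cong {x} {y} (suc n) e = ≈-trans (·-congʳ (x ^ n) e) (·-congˡ y (^-cong n e))

InΓ-· : ∀ x y → InΓ x → InΓ y → InΓ (x · y)
InΓ-· x y hx hy = trans (det-· x y) (cong₂ _*_ hx hy)

InΓ-inv : ∀ x → InΓ x → InΓ (inv x)
InΓ-inv x hx = trans (det-inv x) hx

InΓ-twist : ∀ x → InΓ x → InΓ (twist x)
InΓ-twist x hx = trans (det-twist x) hx

inverseˡ : ∀ x → InΓ x → inv x · x ≡ I
inverseˡ x hx = trans (inv-·-self x) (cong scalar hx)

inverseʳ : ∀ x → InΓ x → x · inv x ≡ I
inverseʳ x hx = subst (λ y → y · inv x ≡ I) (inv-involutive x) (inverseˡ (inv x) (InΓ-inv x hx))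

·-regroup : ∀ u v w p q → u · v · w · (p · q) ≡ u · (v · w · p) · q
·-regroup u v w p q = begin
  u · v · w · (p · q)  ≡⟨ ·-assoc (u · v · w) p q ⟨
  u · v · w · p · q    ≡⟨ cong (λ m → m · p · q) (·-assoc u v w) ⟩
  u · (v · w) · p · q  ≡⟨ cong (_· q) (·-assoc u (v · w) p) ⟩
  u · (v · w · p) · q  ∎
  where open ≡-Reasoning

·-cancel-inner : ∀ δ u v → InΓ δ → u · inv δ · (δ · v) ≡ u · v
·-cancel-inner δ u v hδ = begin
  u · inv δ · (δ · v)    ≡⟨ ·-assoc u (inv δ) (δ · v) ⟩
  u · (inv δ · (δ · v))  ≡⟨ cong (u ·_) (·-assoc (inv δ) δ v) ⟨
  u · (inv δ · δ · v)    ≡⟨ cong (λ m → u · (m · v)) (inverseˡ δ hδ) ⟩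
  u · (I · v)            ≡⟨ cong (u ·_) (·-identityˡ v) ⟩
  u · v                  ∎
  where open ≡-Reasoning

_⋆_ : Mat → Mat → Mat
δ ⋆ x = twist δ · x · inv δ
infixr 6 _⋆_

⋆-identity : ∀ x → I ⋆ x ≡ x
⋆-identity x = trans (·-identityʳ (I · x)) (·-identityˡ x)

⋆-∘ : ∀ x y z → (x · y) ⋆ z ≡ x ⋆ y ⋆ z
⋆-∘ x y z = begin
  twist (x · y) · z · inv (x · y)          ≡⟨ cong₂ (λ u v → u · z · v) (twist-· x y) (inv-anti-· x y) ⟩
  twist x · twist y · z · (inv y · inv x)  ≡⟨ ·-regroup (twist x) (twist y) z (inv y) (inv x) ⟩
  twist x · (twist y · z · inv y) · inv x  ∎
  where open ≡-Reasoning

⋆-cancel : ∀ δ x → InΓ δ → inv δ ⋆ δ ⋆ x ≡ x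
⋆-cancel δ x hδ = begin
  inv δ ⋆ δ ⋆ x   ≡⟨ ⋆-∘ (inv δ) δ x ⟨
  (inv δ · δ) ⋆ x ≡⟨ cong (_⋆ x) (inverseˡ δ hδ) ⟩
  I ⋆ x           ≡⟨ ⋆-identity x ⟩
  x               ∎
  where open ≡-Reasoning

⋆-cong : ∀ δ {x y} → x ≈ y → δ ⋆ x ≈ δ ⋆ y
⋆-cong δ e = ·-congʳ (inv δ) (·-congˡ (twist δ) e)

InΓ-⋆ : ∀ δ x → InΓ δ → InΓ x → InΓ (δ ⋆ x)
InΓ-⋆ δ x hδ hx = InΓ-· (twist δ · x) (inv δ) (InΓ-· (twist δ) x (InΓ-twist δ hδ) hx) (InΓ-inv δ hδ)

≈⇒TwistedConj : ∀ {x y} → x ≈ y → TwistedConj x y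
≈⇒TwistedConj {y = y} x≈y = I , refl , ≈-trans x≈y (≡⇒≈ (sym (⋆-identity y)))

TwistedConj-sym : ∀ {x y} → TwistedConj x y → TwistedConj y x
TwistedConj-sym {x} {y} (δ , hδ , x≈δ⋆y) = inv δ , InΓ-inv δ hδ , (begin
  y             ≡⟨ ⋆-cancel δ y hδ ⟨
  inv δ ⋆ δ ⋆ y ≈⟨ ⋆-cong (inv δ) x≈δ⋆y ⟨
  inv δ ⋆ x     ∎)
  where open ≈-Reasoning

TwistedConj-trans : ∀ {x y z} → TwistedConj x y → TwistedConj y z → TwistedConj x z
TwistedConj-trans {x} {y} {z} (δ , hδ , x≈δ⋆y) (ε , hε , y≈ε⋆z) = δ · ε , InΓ-· δ ε hδ hε , (begin
  x         ≈⟨ x≈δ⋆y ⟩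
  δ ⋆ y     ≈⟨ ⋆-cong δ y≈ε⋆z ⟩
  δ ⋆ ε ⋆ z ≡⟨ ⋆-∘ δ ε z ⟨
  (δ · ε) ⋆ z ∎)
  where open ≈-Reasoning

TwistedConj-⋆ : ∀ δ x → InΓ δ → TwistedConj x (δ ⋆ x)
TwistedConj-⋆ δ x hδ = TwistedConj-sym (δ , hδ , ≈-refl)

-- Conjugation, and transport of the Type 4b structure along twisted conjugacy

conj : Mat → Mat → Mat
conj δ x = δ · x · inv δ

conj-cong : ∀ δ {x y} → x ≈ y → conj δ x ≈ conj δ y
conj-cong δ e = ·-congʳ (inv δ) (·-congˡ δ e)

conj-∘ : ∀ x y z → conj (x · y) z ≡ conj x (conj y z)
conj-∘ x y z = begin
  x · y · z · inv (x · y)      ≡⟨ cong (x · y · z ·_) (inv-anti-· x y) ⟩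
  x · y · z · (inv y · inv x)  ≡⟨ ·-regroup x y z (inv y) (inv x) ⟩
  x · (y · z · inv y) · inv x  ∎
  where open ≡-Reasoning

conj-identity : ∀ x → conj I x ≡ x
conj-identity x = trans (·-identityʳ (I · x)) (·-identityˡ x)

inv-conj : ∀ δ x → inv (conj δ x) ≡ conj δ (inv x)
inv-conj δ x = begin
  inv (δ · x · inv δ)        ≡⟨ inv-anti-· (δ · x) (inv δ) ⟩
  inv (inv δ) · inv (δ · x)  ≡⟨ cong₂ _·_ (inv-involutive δ) (inv-anti-· δ x) ⟩
  δ · (inv x · inv δ)        ≡⟨ ·-assoc δ (inv x) (inv δ) ⟨
  δ · inv x · inv δ          ∎
  where open ≡-Reasoning

conj-I : ∀ δ → InΓ δ → conj δ I ≡ I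
conj-I δ hδ = trans (cong (_· inv δ) (·-identityʳ δ)) (inverseʳ δ hδ)

conj-· : ∀ δ x y → InΓ δ → conj δ x · conj δ y ≡ conj δ (x · y)
conj-· δ x y hδ = begin
  δ · x · inv δ · (δ · y · inv δ)  ≡⟨ ·-assoc (δ · x · inv δ) (δ · y) (inv δ) ⟨
  δ · x · inv δ · (δ · y) · inv δ  ≡⟨ cong (_· inv δ) (·-cancel-inner δ (δ · x) y hδ) ⟩
  δ · x · y · inv δ                ≡⟨ cong (_· inv δ) (·-assoc δ x y) ⟩
  δ · (x · y) · inv δ              ∎
  where open ≡-Reasoning

InΓ-conj : ∀ δ x → InΓ δ → InΓ x → InΓ (conj δ x)
InΓ-conj δ x hδ hx = InΓ-· (δ · x) (inv δ) (InΓ-· δ x hδ hx) (InΓ-inv δ hδ)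

conj-^ : ∀ δ x n → InΓ δ → conj δ (x ^ n) ≡ conj δ x ^ n
conj-^ δ x zero    hδ = conj-I δ hδ
conj-^ δ x (suc n) hδ = trans (sym (conj-· δ x (x ^ n) hδ)) (cong (conj δ x ·_) (conj-^ δ x n hδ))

conj-cancelˡ : ∀ δ x → InΓ δ → conj (inv δ) (conj δ x) ≡ x
conj-cancelˡ δ x hδ = begin
  conj (inv δ) (conj δ x) ≡⟨ conj-∘ (inv δ) δ x ⟨
  conj (inv δ · δ) x      ≡⟨ cong (λ m → conj m x) (inverseˡ δ hδ) ⟩
  conj I x                ≡⟨ conj-identity x ⟩
  x                       ∎
  where open ≡-Reasoning

conj-cancelʳ : ∀ δ x → InΓ δ → conj δ (conj (inv δ) x) ≡ x
conj-cancelʳ δ x hδ = begin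
  conj δ (conj (inv δ) x)             ≡⟨ cong (λ m → conj m (conj (inv δ) x)) (inv-involutive δ) ⟨
  conj (inv (inv δ)) (conj (inv δ) x) ≡⟨ conj-cancelˡ (inv δ) x (InΓ-inv δ hδ) ⟩
  x                                   ∎
  where open ≡-Reasoning

conj≈I⇒≈I : ∀ δ x → InΓ δ → conj δ x ≈ I → x ≈ I
conj≈I⇒≈I δ x hδ e = begin
  x                       ≡⟨ conj-cancelˡ δ x hδ ⟨
  conj (inv δ) (conj δ x) ≈⟨ conj-cong (inv δ) e ⟩
  conj (inv δ) I          ≡⟨ conj-I (inv δ) (InΓ-inv δ hδ) ⟩
  I                       ∎
  where open ≈-Reasoning

conj-conj : ∀ δ g x → InΓ δ → conj (conj δ g) (conj δ x) ≡ conj δ (conj g x)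
conj-conj δ g x hδ = begin
  conj δ g · conj δ x · inv (conj δ g)     ≡⟨ cong (conj δ g · conj δ x ·_) (inv-conj δ g) ⟩
  conj δ g · conj δ x · conj δ (inv g)     ≡⟨ cong (_· conj δ (inv g)) (conj-· δ g x hδ) ⟩
  conj δ (g · x) · conj δ (inv g)          ≡⟨ conj-· δ (g · x) (inv g) hδ ⟩
  conj δ (conj g x)                        ∎
  where open ≡-Reasoning

conj-·-self : ∀ δ σ → InΓ δ → conj δ σ · δ ≡ δ · σ
conj-·-self δ σ hδ = begin
  δ · σ · inv δ · δ     ≡⟨ ·-assoc (δ · σ) (inv δ) δ ⟩
  δ · σ · (inv δ · δ)   ≡⟨ cong (δ · σ ·_) (inverseˡ δ hδ) ⟩
  δ · σ · I             ≡⟨ ·-identityʳ (δ · σ) ⟩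
  δ · σ                 ∎
  where open ≡-Reasoning

InZ-conj : ∀ δ h σ → InΓ δ → InZ h σ → InZ (δ ⋆ h) (conj δ σ)
InZ-conj δ h σ hδ (hσ , σ⋆h≈h) = InΓ-conj δ σ hδ hσ , (begin
  conj δ σ ⋆ δ ⋆ h     ≡⟨ ⋆-∘ (conj δ σ) δ h ⟨
  (conj δ σ · δ) ⋆ h   ≡⟨ cong (_⋆ h) (conj-·-self δ σ hδ) ⟩
  (δ · σ) ⋆ h          ≡⟨ ⋆-∘ δ σ h ⟩
  δ ⋆ σ ⋆ h            ≈⟨ ⋆-cong δ σ⋆h≈h ⟩
  δ ⋆ h                ∎)
  where open ≈-Reasoning

InZ-resp-≈ : ∀ g g' σ → g ≈ g' → InZ g σ → InZ g' σ
InZ-resp-≈ g g' σ g≈g' (hσ , σ⋆g≈g) = hσ , (begin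
  σ ⋆ g' ≈⟨ ⋆-cong σ g≈g' ⟨
  σ ⋆ g  ≈⟨ σ⋆g≈g ⟩
  g      ≈⟨ g≈g' ⟩
  g'     ∎)
  where open ≈-Reasoning

InZ-unconj : ∀ δ h σ → InΓ δ → InZ (δ ⋆ h) σ → InZ h (conj (inv δ) σ)
InZ-unconj δ h σ hδ zσ =
  InZ-resp-≈ _ h (conj (inv δ) σ) (≡⇒≈ (⋆-cancel δ h hδ)) (InZ-conj (inv δ) (δ ⋆ h) σ (InΓ-inv δ hδ) zσ)

conj-alternating : ∀ δ s t n → InΓ δ → conj δ ((s · t) ^ n) ≡ (conj δ s · conj δ t) ^ n
conj-alternating δ s t n hδ = trans (conj-^ δ (s · t) n hδ) (cong (_^ n) (sym (conj-· δ s t hδ)))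

conj-alternating-· : ∀ δ s t u n → InΓ δ →
                     conj δ ((s · t) ^ n · u) ≡ (conj δ s · conj δ t) ^ n · conj δ u
conj-alternating-· δ s t u n hδ =
  trans (sym (conj-· δ ((s · t) ^ n) u hδ)) (cong (_· conj δ u) (conj-alternating δ s t n hδ))

Generated-resp-≈ : ∀ {s t σ σ'} → σ ≈ σ' → Generated s t σ' → Generated s t σ
Generated-resp-≈ e (n , inj₁ x)               = n , inj₁ (≈-trans e x)
Generated-resp-≈ e (n , inj₂ (inj₁ x))        = n , inj₂ (inj₁ (≈-trans e x))
Generated-resp-≈ e (n , inj₂ (inj₂ (inj₁ x))) = n , inj₂ (inj₂ (inj₁ (≈-trans e x)))
Generated-resp-≈ e (n , inj₂ (inj₂ (inj₂ x))) = n , inj₂ (inj₂ (inj₂ (≈-trans e x)))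

Generated-conj : ∀ δ {s t τ} → InΓ δ → Generated s t τ → Generated (conj δ s) (conj δ t) (conj δ τ)
Generated-conj δ {s} {t} hδ (n , inj₁ x) =
  n , inj₁ (≈-trans (conj-cong δ x) (≡⇒≈ (conj-alternating δ s t n hδ)))
Generated-conj δ {s} {t} hδ (n , inj₂ (inj₁ x)) =
  n , inj₂ (inj₁ (≈-trans (conj-cong δ x) (≡⇒≈ (conj-alternating δ t s n hδ))))
Generated-conj δ {s} {t} hδ (n , inj₂ (inj₂ (inj₁ x))) =
  n , inj₂ (inj₂ (inj₁ (≈-trans (conj-cong δ x) (≡⇒≈ (conj-alternating-· δ s t s n hδ)))))
Generated-conj δ {s} {t} hδ (n , inj₂ (inj₂ (inj₂ x))) =
  n , inj₂ (inj₂ (inj₂ (≈-trans (conj-cong δ x) (≡⇒≈ (conj-alternating-· δ t s t n hδ)))))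

Involution-conj : ∀ δ {s} → InΓ δ → Involution s → Involution (conj δ s)
Involution-conj δ {s} hδ (s·s≈I , s≉I) =
  ≈-trans (≡⇒≈ (conj-· δ s s hδ)) (≈-trans (conj-cong δ s·s≈I) (≡⇒≈ (conj-I δ hδ))) ,
  λ e → s≉I (conj≈I⇒≈I δ s hδ e)

InfDihedralPair-conj : ∀ δ {s t} → InΓ δ → InfDihedralPair s t → InfDihedralPair (conj δ s) (conj δ t)
InfDihedralPair-conj δ {s} {t} hδ (inv-s , inv-t , infinite) =
  Involution-conj δ hδ inv-s , Involution-conj δ hδ inv-t ,
  λ n e → infinite n (conj≈I⇒≈I δ _ hδ (≈-trans (≡⇒≈ (conj-alternating δ s t (suc n) hδ)) e))

Type4b-⋆ : ∀ δ h → InΓ δ → Type4b h → Type4b (δ ⋆ h)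
Type4b-⋆ δ h hδ (s , t , zs , zt , dihedral , generates , g , hg , gsg⁻¹≈t) =
  conj δ s , conj δ t , InZ-conj δ h s hδ zs , InZ-conj δ h t hδ zt , InfDihedralPair-conj δ hδ dihedral ,
  generates′ , conj δ g , InΓ-conj δ g hδ hg ,
  ≈-trans (≡⇒≈ (conj-conj δ g s hδ)) (conj-cong δ gsg⁻¹≈t)
  where
  generates′ : ∀ σ → InZ (δ ⋆ h) σ → Generated (conj δ s) (conj δ t) σ
  generates′ σ zσ = Generated-resp-≈ (≡⇒≈ (sym (conj-cancelʳ δ σ hδ)))
    (Generated-conj δ hδ (generates (conj (inv δ) σ) (InZ-unconj δ h σ hδ zσ)))

Type4b-resp-≈ : ∀ g g' → g ≈ g' → Type4b g → Type4b g'
Type4b-resp-≈ g g' g≈g' (s , t , zs , zt , dihedral , generates , conjugate) =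
  s , t , InZ-resp-≈ g g' s g≈g' zs , InZ-resp-≈ g g' t g≈g' zt , dihedral ,
  (λ σ zσ → generates σ (InZ-resp-≈ g' g σ (≈-sym g≈g') zσ)) , conjugate

Type4b-TwistedConj : ∀ g h → TwistedConj g h → Type4b h → Type4b g
Type4b-TwistedConj g h (δ , hδ , g≈δ⋆h) t4b = Type4b-resp-≈ (δ ⋆ h) g (≈-sym g≈δ⋆h) (Type4b-⋆ δ h hδ t4b)

-- Every admissible element is twisted conjugate to I

ℕ-2*≢1 : ∀ n → 2 ℕ.* n ≢ 1
ℕ-2*≢1 zero          ()
ℕ-2*≢1 (suc zero)    ()
ℕ-2*≢1 (suc (suc n)) ()

2*≢1 : ∀ x → + 2 * x ≢ + 1
2*≢1 x e = ℕ-2*≢1 ∣ x ∣ (trans (sym (ℤ.abs-* (+ 2) x)) (cong ∣_∣ e))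

admissible : ℤ → ℤ → ℤ → Mat
admissible p q r = mat p q (- q) r

Admissible⇒≡admissible : ∀ g → InΓ g → Admissible g → g ≡ admissible (a g) (b g) (d g)
Admissible⇒≡admissible g hg (inj₁ (_ , k≡-b , _ , _)) = mat-≡ refl refl k≡-b refl
Admissible⇒≡admissible (mat a b k d) hg (inj₂ (d≡-d , k≡--b , _ , a≡-a)) =
  ⊥-elim (2*≢1 (- (b * b)) (trans (sym (det-antidiagonal b)) (subst InΓ g≡antidiagonal hg)))
  where
  self-negating : ∀ {x} → x ≡ - x → x ≡ + 0
  self-negating {+ zero}   _  = refl
  self-negating {+[1+ _ ]} ()
  self-negating { -[1+ _ ]} ()
  g≡antidiagonal : mat a b k d ≡ mat (+ 0) b b (+ 0)
  g≡antidiagonal = mat-≡ (self-negating a≡-a) refl (trans k≡--b (ℤ.neg-involutive b)) (self-negating d≡-d)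
  det-antidiagonal : ∀ x → + 0 * + 0 - x * (+ 2 * x) ≡ + 2 * - (x * x)
  det-antidiagonal = solve-∀

∣m⊖n∣<m : ∀ m n → 0 < n → n < 2 ℕ.* m → ∣ m ⊖ n ∣ < m
∣m⊖n∣<m zero      n 0<n ()
∣m⊖n∣<m m@(suc _) n 0<n n<2m with n ℕ.≤? m
... | yes n≤m = subst (_< m) (sym (cong ∣_∣ (ℤ.⊖-≥ n≤m))) (ℕ.∸-monoʳ-< 0<n n≤m)
... | no  n≰m = subst (_< m) (sym (ℤ.∣⊖∣-≰ n≰m))
                  (ℕ.m<n+o⇒m∸n<o n m (subst (n <_) (cong (m ℕ.+_) (ℕ.+-identityʳ m)) n<2m))

∣x-y∣<∣x∣⊎∣x+y∣<∣x∣ : ∀ x y → 0 < ∣ y ∣ → ∣ y ∣ < 2 ℕ.* ∣ x ∣ → ∣ x - y ∣ < ∣ x ∣ ⊎ ∣ x + y ∣ < ∣ x ∣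
∣x-y∣<∣x∣⊎∣x+y∣<∣x∣ x        (+ zero)   () _
∣x-y∣<∣x∣⊎∣x+y∣<∣x∣ (+ m)    +[1+ n ]   0<y y<2x = inj₁ (∣m⊖n∣<m m (suc n) 0<y y<2x)
∣x-y∣<∣x∣⊎∣x+y∣<∣x∣ (+ m)    -[1+ n ]   0<y y<2x = inj₂ (∣m⊖n∣<m m (suc n) 0<y y<2x)
∣x-y∣<∣x∣⊎∣x+y∣<∣x∣ -[1+ m ] +[1+ n ]   0<y y<2x =
  inj₂ (subst (_< suc m) (ℤ.∣m⊖n∣≡∣n⊖m∣ (suc m) (suc n)) (∣m⊖n∣<m (suc m) (suc n) 0<y y<2x))
∣x-y∣<∣x∣⊎∣x+y∣<∣x∣ -[1+ m ] -[1+ n ]   0<y y<2x =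
  inj₁ (subst (_< suc m) (ℤ.∣m⊖n∣≡∣n⊖m∣ (suc m) (suc n)) (∣m⊖n∣<m (suc m) (suc n) 0<y y<2x))

no-large-factors : ∀ P Q R → 0 < Q → 2 ℕ.* Q ≤ P → 2 ℕ.* Q ≤ R → P ℕ.* R ≤ 1 ℕ.+ 2 ℕ.* (Q ℕ.* Q) → ⊥
no-large-factors P Q R 0<Q 2Q≤P 2Q≤R PR≤1+2QQ = 2≰1 (ℕ.≤-trans 2≤2QQ 2QQ≤1)
  where
  2≰1 : ¬ 2 ≤ 1
  2≰1 (s≤s ())
  open ℕ.≤-Reasoning
  2≤2QQ : 2 ≤ 2 ℕ.* (Q ℕ.* Q)
  2≤2QQ = ℕ.*-monoʳ-≤ 2 (ℕ.*-mono-≤ 0<Q 0<Q)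
  2QQ≤1 : 2 ℕ.* (Q ℕ.* Q) ≤ 1
  2QQ≤1 = ℕ.+-cancelʳ-≤ (2 ℕ.* (Q ℕ.* Q)) _ _ (begin
    2 ℕ.* (Q ℕ.* Q) ℕ.+ 2 ℕ.* (Q ℕ.* Q) ≡⟨ solve (Q ∷ []) ⟩
    (2 ℕ.* Q) ℕ.* (2 ℕ.* Q)             ≤⟨ ℕ.*-mono-≤ 2Q≤P 2Q≤R ⟩
    P ℕ.* R                             ≤⟨ PR≤1+2QQ ⟩
    1 ℕ.+ 2 ℕ.* (Q ℕ.* Q)               ∎)

det-admissible : ∀ p q r → det (admissible p q r) ≡ p * r + + 2 * (q * q)
det-admissible p q r = expand p q r
  where
  expand : ∀ p q r → p * r - q * (+ 2 * - q) ≡ p * r + + 2 * (q * q)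
  expand = solve-∀

nonzero-factor : ∀ p r q → p * r + + 2 * (q * q) ≡ + 1 → 0 < ∣ p ∣
nonzero-factor (+ zero)   r q e = ⊥-elim (2*≢1 (q * q) (trans (sym (ℤ.+-identityˡ _)) e))
nonzero-factor +[1+ _ ]   r q e = s≤s z≤n
nonzero-factor -[1+ _ ]   r q e = s≤s z≤n

factors-bounded : ∀ p q r → p * r + + 2 * (q * q) ≡ + 1 →
                  ∣ p ∣ ℕ.* ∣ r ∣ ≤ 1 ℕ.+ 2 ℕ.* (∣ q ∣ ℕ.* ∣ q ∣)
factors-bounded p q r e = begin
  ∣ p ∣ ℕ.* ∣ r ∣                    ≡⟨ ℤ.abs-* p r ⟨
  ∣ p * r ∣                          ≡⟨ cong ∣_∣ pr≡1-2qq ⟩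
  ∣ + 1 - + 2 * (q * q) ∣            ≤⟨ ℤ.∣i-j∣≤∣i∣+∣j∣ (+ 1) (+ 2 * (q * q)) ⟩
  1 ℕ.+ ∣ + 2 * (q * q) ∣            ≡⟨ cong (1 ℕ.+_) ∣2qq∣ ⟩
  1 ℕ.+ 2 ℕ.* (∣ q ∣ ℕ.* ∣ q ∣)      ∎
  where
  open ℕ.≤-Reasoning
  ∣2qq∣ : ∣ + 2 * (q * q) ∣ ≡ 2 ℕ.* (∣ q ∣ ℕ.* ∣ q ∣)
  ∣2qq∣ = trans (ℤ.abs-* (+ 2) (q * q)) (cong (2 ℕ.*_) (ℤ.abs-* q q))
  pr≡1-2qq : p * r ≡ + 1 - + 2 * (q * q)
  pr≡1-2qq = trans (add-sub (p * r) (+ 2 * (q * q))) (cong (_- + 2 * (q * q)) e)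
    where
    add-sub : ∀ x y → x ≡ x + y - y
    add-sub = solve-∀

T⁺ T⁻ L⁺ L⁻ : Mat
T⁺ = mat (+ 1) (+ 1) (+ 0) (+ 1)
T⁻ = mat (+ 1) (- + 1) (+ 0) (+ 1)
L⁺ = mat (+ 1) (+ 0) (+ 1) (+ 1)
L⁻ = mat (+ 1) (+ 0) (- + 1) (+ 1)

T⁺-move : ∀ p q r → T⁺ ⋆ admissible p q r ≡ admissible p (q - p) (r + + 4 * q - + 2 * p)
T⁺-move p q r = mat-≡ (a-entry p q r) (b-entry p q r) (k-entry p q r) (d-entry p q r)
  where
  a-entry : ∀ p q r → (+ 1 * p + + 0 * (+ 2 * - q)) * + 1 + (+ 1 * q + + 0 * r) * (+ 2 * - + 0) ≡ p
  a-entry = solve-∀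
  b-entry : ∀ p q r → (+ 1 * p + + 0 * (+ 2 * - q)) * - + 1 + (+ 1 * q + + 0 * r) * + 1 ≡ q - p
  b-entry = solve-∀
  k-entry : ∀ p q r → (+ 1 * p + + 1 * - q) * + 1 + (+ 2 * + 1 * q + + 1 * r) * - + 0 ≡ - (q - p)
  k-entry = solve-∀
  d-entry : ∀ p q r → + 2 * (+ 1 * p + + 1 * - q) * - + 1 + (+ 2 * + 1 * q + + 1 * r) * + 1
                      ≡ r + + 4 * q - + 2 * p
  d-entry = solve-∀

T⁻-move : ∀ p q r → T⁻ ⋆ admissible p q r ≡ admissible p (q + p) (r - + 4 * q - + 2 * p)
T⁻-move p q r = mat-≡ (a-entry p q r) (b-entry p q r) (k-entry p q r) (d-entry p q r)
  where
  a-entry : ∀ p q r → (+ 1 * p + + 0 * (+ 2 * - q)) * + 1 + (+ 1 * q + + 0 * r) * (+ 2 * - + 0) ≡ p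
  a-entry = solve-∀
  b-entry : ∀ p q r → (+ 1 * p + + 0 * (+ 2 * - q)) * - - + 1 + (+ 1 * q + + 0 * r) * + 1 ≡ q + p
  b-entry = solve-∀
  k-entry : ∀ p q r → (- + 1 * p + + 1 * - q) * + 1 + (+ 2 * - + 1 * q + + 1 * r) * - + 0 ≡ - (q + p)
  k-entry = solve-∀
  d-entry : ∀ p q r → + 2 * (- + 1 * p + + 1 * - q) * - - + 1 + (+ 2 * - + 1 * q + + 1 * r) * + 1
                      ≡ r - + 4 * q - + 2 * p
  d-entry = solve-∀

L⁺-move : ∀ p q r → L⁺ ⋆ admissible p q r ≡ admissible (p - + 4 * q - + 2 * r) (q + r) r
L⁺-move p q r = mat-≡ (a-entry p q r) (b-entry p q r) (k-entry p q r) (d-entry p q r)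
  where
  a-entry : ∀ p q r → (+ 1 * p + + 1 * (+ 2 * - q)) * + 1 + (+ 1 * q + + 1 * r) * (+ 2 * - + 1)
                      ≡ p - + 4 * q - + 2 * r
  a-entry = solve-∀
  b-entry : ∀ p q r → (+ 1 * p + + 1 * (+ 2 * - q)) * - + 0 + (+ 1 * q + + 1 * r) * + 1 ≡ q + r
  b-entry = solve-∀
  k-entry : ∀ p q r → (+ 0 * p + + 1 * - q) * + 1 + (+ 2 * + 0 * q + + 1 * r) * - + 1 ≡ - (q + r)
  k-entry = solve-∀
  d-entry : ∀ p q r → + 2 * (+ 0 * p + + 1 * - q) * - + 0 + (+ 2 * + 0 * q + + 1 * r) * + 1 ≡ r
  d-entry = solve-∀

L⁻-move : ∀ p q r → L⁻ ⋆ admissible p q r ≡ admissible (p + + 4 * q - + 2 * r) (q - r) r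
L⁻-move p q r = mat-≡ (a-entry p q r) (b-entry p q r) (k-entry p q r) (d-entry p q r)
  where
  a-entry : ∀ p q r → (+ 1 * p + - + 1 * (+ 2 * - q)) * + 1 + (+ 1 * q + - + 1 * r) * (+ 2 * - - + 1)
                      ≡ p + + 4 * q - + 2 * r
  a-entry = solve-∀
  b-entry : ∀ p q r → (+ 1 * p + - + 1 * (+ 2 * - q)) * - + 0 + (+ 1 * q + - + 1 * r) * + 1 ≡ q - r
  b-entry = solve-∀
  k-entry : ∀ p q r → (+ 0 * p + + 1 * - q) * + 1 + (+ 2 * + 0 * q + + 1 * r) * - - + 1 ≡ - (q - r)
  k-entry = solve-∀
  d-entry : ∀ p q r → + 2 * (+ 0 * p + + 1 * - q) * - + 0 + (+ 2 * + 0 * q + + 1 * r) * + 1 ≡ r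
  d-entry = solve-∀

record Shortening (p q r : ℤ) : Set where
  field
    T        : Mat
    T∈Γ      : InΓ T
    p′ q′ r′ : ℤ
    moves    : T ⋆ admissible p q r ≡ admissible p′ q′ r′
    shorter  : ∣ q′ ∣ < ∣ q ∣

shortening : ∀ p q r → 0 < ∣ q ∣ → p * r + + 2 * (q * q) ≡ + 1 → Shortening p q r
shortening p q r 0<q e with ∣ p ∣ <? 2 ℕ.* ∣ q ∣
... | yes p-small with ∣x-y∣<∣x∣⊎∣x+y∣<∣x∣ q p (nonzero-factor p r q e) p-small
...   | inj₁ shorter = record { T = T⁺ ; T∈Γ = refl ; moves = T⁺-move p q r ; shorter = shorter }
...   | inj₂ shorter = record { T = T⁻ ; T∈Γ = refl ; moves = T⁻-move p q r ; shorter = shorter }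
shortening p q r 0<q e | no p-large with ∣ r ∣ <? 2 ℕ.* ∣ q ∣
... | yes r-small
      with ∣x-y∣<∣x∣⊎∣x+y∣<∣x∣ q r (nonzero-factor r p q (trans (cong (_+ _) (ℤ.*-comm r p)) e)) r-small
...   | inj₁ shorter = record { T = L⁻ ; T∈Γ = refl ; moves = L⁻-move p q r ; shorter = shorter }
...   | inj₂ shorter = record { T = L⁺ ; T∈Γ = refl ; moves = L⁺-move p q r ; shorter = shorter }
shortening p q r 0<q e | no p-large | no r-large =
  ⊥-elim (no-large-factors (∣ p ∣) (∣ q ∣) (∣ r ∣) 0<q (ℕ.≮⇒≥ p-large) (ℕ.≮⇒≥ r-large)
                           (factors-bounded p q r e))

∣i∣≡1⇒i≡±1 : ∀ i → ∣ i ∣ ≡ 1 → i ≡ + 1 ⊎ i ≡ - + 1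
∣i∣≡1⇒i≡±1 (+ .1)     refl = inj₁ refl
∣i∣≡1⇒i≡±1 -[1+ .0 ]  refl = inj₂ refl

unit-factors⇒≈I : ∀ p r → p * r ≡ + 1 → admissible p (+ 0) r ≈ I
unit-factors⇒≈I p r pr≡1 =
  signs (∣i∣≡1⇒i≡±1 p (ℕ.m*n≡1⇒m≡1 (∣ p ∣) (∣ r ∣) ∣pr∣≡1))
        (∣i∣≡1⇒i≡±1 r (ℕ.m*n≡1⇒n≡1 (∣ p ∣) (∣ r ∣) ∣pr∣≡1)) pr≡1
  where
  ∣pr∣≡1 : ∣ p ∣ ℕ.* ∣ r ∣ ≡ 1
  ∣pr∣≡1 = trans (sym (ℤ.abs-* p r)) (cong ∣_∣ pr≡1)
  signs : p ≡ + 1 ⊎ p ≡ - + 1 → r ≡ + 1 ⊎ r ≡ - + 1 → p * r ≡ + 1 → admissible p (+ 0) r ≈ I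
  signs (inj₁ refl) (inj₁ refl) _  = ≈-refl
  signs (inj₂ refl) (inj₂ refl) _  = ≡neg⇒≈ refl
  signs (inj₁ refl) (inj₂ refl) ()
  signs (inj₂ refl) (inj₁ refl) ()

TwistedConj-admissible-I : ∀ p q r → InΓ (admissible p q r) → TwistedConj (admissible p q r) I
TwistedConj-admissible-I p q r = <-rec Goal descend ∣ q ∣ p q r refl
  where
  Goal : ℕ → Set
  Goal n = ∀ p q r → ∣ q ∣ ≡ n → InΓ (admissible p q r) → TwistedConj (admissible p q r) I

  descend-by : ∀ {p q r} → Shortening p q r → (∀ {m} → m < ∣ q ∣ → Goal m) →
               InΓ (admissible p q r) → TwistedConj (admissible p q r) I
  descend-by {p} {q} {r} S rec h =
    TwistedConj-trans (subst (TwistedConj (admissible p q r)) moves (TwistedConj-⋆ T (admissible p q r) T∈Γ))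
                      (rec shorter p′ q′ r′ refl (subst InΓ moves (InΓ-⋆ T (admissible p q r) T∈Γ h)))
    where open Shortening S

  descend : ∀ n → (∀ {m} → m < n → Goal m) → Goal n
  descend _ _ p (+ zero) r _ h =
    ≈⇒TwistedConj (unit-factors⇒≈I p r
      (trans (sym (ℤ.+-identityʳ (p * r))) (trans (sym (det-admissible p (+ 0) r)) h)))
  descend _ rec p q@(+[1+ _ ]) r refl h =
    descend-by (shortening p q r (s≤s z≤n) (trans (sym (det-admissible p q r)) h)) rec h
  descend _ rec p q@(-[1+ _ ]) r refl h =
    descend-by (shortening p q r (s≤s z≤n) (trans (sym (det-admissible p q r)) h)) rec h

Admissible⇒TwistedConj-I : ∀ g → InΓ g → Admissible g → TwistedConj g I
Admissible⇒TwistedConj-I g hg ag = subst (λ x → TwistedConj x I) (sym g≡adm)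
  (TwistedConj-admissible-I (a g) (b g) (d g) (subst InΓ g≡adm hg))
  where
  g≡adm : g ≡ admissible (a g) (b g) (d g)
  g≡adm = Admissible⇒≡admissible g hg ag

-- The twisted centraliser of I

-- symm x y = [[x, y], [2y, x]] and antisymm p q = [[p, q], [−2q, −p]] are the matrices
-- with σᶜ = σ and σᶜ = −σ respectively.
symm antisymm : ℤ → ℤ → Mat
symm x y     = mat x y y x
antisymm p q = mat p q (- q) (- p)

-- s₀ and t₀ are the half-turns about the elliptic points (−1 + i)/2 and (1 + i)/2,
-- which lie on the geodesic C_I = {|z|² = 1/2} and are exchanged by z ↦ z + 1.
s₀ t₀ : Mat
s₀ = mat (+ 1) (+ 1) (- + 1) (- + 1)
t₀ = mat (- + 1) (+ 1) (- + 1) (+ 1)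

U V : Mat
U = symm (+ 3) (+ 2)
V = symm (+ 3) (- + 2)

t₀s₀≈U : t₀ · s₀ ≈ U
t₀s₀≈U = ≡neg⇒≈ refl

s₀t₀≈V : s₀ · t₀ ≈ V
s₀t₀≈V = ≡neg⇒≈ refl

U-·-symm : ∀ x y → U · symm x y ≡ symm (+ 3 * x + + 4 * y) (+ 2 * x + + 3 * y)
U-·-symm x y = mat-≡ (a-entry x y) (ℤ.+-comm (+ 3 * y) (+ 2 * x)) refl (d-entry x y)
  where
  a-entry : ∀ x y → + 3 * x + + 2 * (+ 2 * y) ≡ + 3 * x + + 4 * y
  a-entry = solve-∀
  d-entry : ∀ x y → + 2 * + 2 * y + + 3 * x ≡ + 3 * x + + 4 * y
  d-entry = solve-∀

V-·-symm : ∀ x y → V · symm x (- y) ≡ symm (+ 3 * x + + 4 * y) (- (+ 2 * x + + 3 * y))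
V-·-symm x y = mat-≡ (a-entry x y) (b-entry x y) (k-entry x y) (d-entry x y)
  where
  a-entry : ∀ x y → + 3 * x + - + 2 * (+ 2 * - y) ≡ + 3 * x + + 4 * y
  a-entry = solve-∀
  b-entry : ∀ x y → + 3 * - y + - + 2 * x ≡ - (+ 2 * x + + 3 * y)
  b-entry = solve-∀
  k-entry : ∀ x y → - + 2 * x + + 3 * - y ≡ - (+ 2 * x + + 3 * y)
  k-entry = solve-∀
  d-entry : ∀ x y → + 2 * - + 2 * - y + + 3 * x ≡ + 3 * x + + 4 * y
  d-entry = solve-∀

+-linear : ∀ i j x y → + (i ℕ.* x ℕ.+ j ℕ.* y) ≡ + i * + x + + j * + y
+-linear i j x y = trans (ℤ.pos-+ (i ℕ.* x) (j ℕ.* y)) (cong₂ _+_ (ℤ.pos-* i x) (ℤ.pos-* j y))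

U-power : ∀ n → U ^ n ≡ symm (+ proj₁ (pell n)) (+ proj₂ (pell n))
U-power zero    = refl
U-power (suc n) = trans (cong (U ·_) (U-power n))
  (trans (U-·-symm (+ x) (+ y)) (sym (cong₂ symm (+-linear 3 4 x y) (+-linear 2 3 x y))))
  where
  x = proj₁ (pell n)
  y = proj₂ (pell n)

V-power : ∀ n → V ^ n ≡ symm (+ proj₁ (pell n)) (- + proj₂ (pell n))
V-power zero    = refl
V-power (suc n) = trans (cong (V ·_) (V-power n))
  (trans (V-·-symm (+ x) (+ y)) (sym (cong₂ (λ u v → symm u (- v)) (+-linear 3 4 x y) (+-linear 2 3 x y))))
  where
  x = proj₁ (pell n)
  y = proj₂ (pell n)

square-abs : ∀ i → i * i ≡ + (∣ i ∣ ℕ.* ∣ i ∣)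
square-abs (+ n)    = ℤ.+◃n≡+n (n ℕ.* n)
square-abs -[1+ n ] = refl

i≡±∣i∣ : ∀ i → i ≡ + ∣ i ∣ ⊎ i ≡ - + ∣ i ∣
i≡±∣i∣ (+ n)    = inj₁ refl
i≡±∣i∣ -[1+ n ] = inj₂ refl

InΓ-symm⇒PellSolution : ∀ p q → InΓ (symm p q) → PellSolution ∣ p ∣ ∣ q ∣
InΓ-symm⇒PellSolution p q h = ℤ.+-injective (begin
  + (∣ p ∣ ℕ.* ∣ p ∣)                          ≡⟨ square-abs p ⟨
  p * p                                        ≡⟨ expand p q ⟩
  p * p - q * (+ 2 * q) + + 2 * (q * q)        ≡⟨ cong (_+ + 2 * (q * q)) h ⟩
  + 1 + + 2 * (q * q)                          ≡⟨ cong (λ m → + 1 + + 2 * m) (square-abs q) ⟩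
  + 1 + + 2 * + (∣ q ∣ ℕ.* ∣ q ∣)             ≡⟨ +-linear 1 2 1 (∣ q ∣ ℕ.* ∣ q ∣) ⟨
  + (1 ℕ.* 1 ℕ.+ 2 ℕ.* (∣ q ∣ ℕ.* ∣ q ∣))     ∎)
  where
  open ≡-Reasoning
  expand : ∀ p q → p * p ≡ p * p - q * (+ 2 * q) + + 2 * (q * q)
  expand = solve-∀

symm-in-⟨s₀t₀⟩ : ∀ p q → InΓ (symm p q) → Σ ℕ λ n → symm p q ≈ (s₀ · t₀) ^ n ⊎ symm p q ≈ (t₀ · s₀) ^ n
symm-in-⟨s₀t₀⟩ p q h with pell-complete ∣ p ∣ ∣ q ∣ (InΓ-symm⇒PellSolution p q h)
... | n , pell-n = n , signs (i≡±∣i∣ p) (i≡±∣i∣ q)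
  where
  P = ∣ p ∣
  Q = ∣ q ∣
  ts≈ : (t₀ · s₀) ^ n ≈ symm (+ P) (+ Q)
  ts≈ = ≈-trans (^-cong n t₀s₀≈U)
          (≡⇒≈ (trans (U-power n) (cong (λ e → symm (+ proj₁ e) (+ proj₂ e)) pell-n)))
  st≈ : (s₀ · t₀) ^ n ≈ symm (+ P) (- + Q)
  st≈ = ≈-trans (^-cong n s₀t₀≈V)
          (≡⇒≈ (trans (V-power n) (cong (λ e → symm (+ proj₁ e) (- + proj₂ e)) pell-n)))
  signs : p ≡ + P ⊎ p ≡ - + P → q ≡ + Q ⊎ q ≡ - + Q → symm p q ≈ (s₀ · t₀) ^ n ⊎ symm p q ≈ (t₀ · s₀) ^ n
  signs (inj₁ p≡) (inj₁ q≡) = inj₂ (≈-trans (≡⇒≈ (cong₂ symm p≡ q≡)) (≈-sym ts≈))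
  signs (inj₂ p≡) (inj₂ q≡) = inj₂ (≈-trans (≡neg⇒≈ (cong₂ symm p≡ q≡)) (≈-sym ts≈))
  signs (inj₁ p≡) (inj₂ q≡) = inj₁ (≈-trans (≡⇒≈ (cong₂ symm p≡ q≡)) (≈-sym st≈))
  signs (inj₂ p≡) (inj₁ q≡) =
    inj₁ (≈-trans (≡neg⇒≈ (cong₂ symm p≡ (trans q≡ (sym (ℤ.neg-involutive (+ Q)))))) (≈-sym st≈))

^-suc-comm : ∀ x n → x ^ suc n ≡ x ^ n · x
^-suc-comm x zero    = trans (·-identityʳ x) (sym (·-identityˡ x))
^-suc-comm x (suc n) = trans (cong (x ·_) (^-suc-comm x n)) (sym (·-assoc x (x ^ n) x))

alternating-·-involution : ∀ s t n → s · s ≈ I → (t · s) ^ suc n · s ≈ (t · s) ^ n · t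
alternating-·-involution s t n s·s≈I = begin
  (t · s) ^ suc n · s     ≡⟨ cong (_· s) (^-suc-comm (t · s) n) ⟩
  (t · s) ^ n · (t · s) · s ≡⟨ ·-assoc ((t · s) ^ n) (t · s) s ⟩
  (t · s) ^ n · (t · s · s) ≡⟨ cong ((t · s) ^ n ·_) (·-assoc t s s) ⟩
  (t · s) ^ n · (t · (s · s)) ≈⟨ ·-congˡ ((t · s) ^ n) (·-congˡ t s·s≈I) ⟩
  (t · s) ^ n · (t · I)   ≡⟨ cong ((t · s) ^ n ·_) (·-identityʳ t) ⟩
  (t · s) ^ n · t         ∎
  where open ≈-Reasoning

⋆I≈I⇒twist≈ : ∀ τ → InΓ τ → τ ⋆ I ≈ I → twist τ ≈ τ
⋆I≈I⇒twist≈ τ hτ τ⋆I≈I = begin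
  twist τ                       ≡⟨ ·-identityʳ (twist τ) ⟨
  twist τ · I                   ≡⟨ ·-identityʳ (twist τ · I) ⟨
  twist τ · I · I               ≡⟨ cong (twist τ · I ·_) (inverseˡ τ hτ) ⟨
  twist τ · I · (inv τ · τ)     ≡⟨ ·-assoc (twist τ · I) (inv τ) τ ⟨
  (τ ⋆ I) · τ                   ≈⟨ ·-congʳ τ τ⋆I≈I ⟩
  I · τ                         ≡⟨ ·-identityˡ τ ⟩
  τ                             ∎
  where open ≈-Reasoning

s₀·s₀≈I : s₀ · s₀ ≈ I
s₀·s₀≈I = ≡neg⇒≈ refl

antisymm-·-s₀ : ∀ p q → antisymm p q · s₀ ≡ symm (p - + 2 * q) (p - q)
antisymm-·-s₀ p q = mat-≡ (a-entry p q) (b-entry p q) (k-entry p q) (d-entry p q)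
  where
  a-entry : ∀ p q → p * + 1 + q * (+ 2 * - + 1) ≡ p - + 2 * q
  a-entry = solve-∀
  b-entry : ∀ p q → p * + 1 + q * - + 1 ≡ p - q
  b-entry = solve-∀
  k-entry : ∀ p q → - q * + 1 + - p * - + 1 ≡ p - q
  k-entry = solve-∀
  d-entry : ∀ p q → + 2 * - q * + 1 + - p * - + 1 ≡ p - + 2 * q
  d-entry = solve-∀

antisymm≈symm-·-s₀ : ∀ p q → antisymm p q ≈ symm (p - + 2 * q) (p - q) · s₀
antisymm≈symm-·-s₀ p q = begin
  antisymm p q                       ≡⟨ ·-identityʳ (antisymm p q) ⟨
  antisymm p q · I                   ≈⟨ ·-congˡ (antisymm p q) s₀·s₀≈I ⟨
  antisymm p q · (s₀ · s₀)           ≡⟨ ·-assoc (antisymm p q) s₀ s₀ ⟨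
  antisymm p q · s₀ · s₀             ≡⟨ cong (_· s₀) (antisymm-·-s₀ p q) ⟩
  symm (p - + 2 * q) (p - q) · s₀    ∎
  where open ≈-Reasoning

Generated-symm : ∀ p q → InΓ (symm p q) → Generated s₀ t₀ (symm p q)
Generated-symm p q h with symm-in-⟨s₀t₀⟩ p q h
... | n , inj₁ e = n , inj₁ e
... | n , inj₂ e = n , inj₂ (inj₁ e)

Generated-antisymm : ∀ p q → InΓ (antisymm p q) → Generated s₀ t₀ (antisymm p q)
Generated-antisymm p q h = from-symm (symm-in-⟨s₀t₀⟩ (p - + 2 * q) (p - q) h′)
  where
  h′ : InΓ (symm (p - + 2 * q) (p - q))
  h′ = subst InΓ (antisymm-·-s₀ p q) (InΓ-· (antisymm p q) s₀ h refl)
  σ = symm (p - + 2 * q) (p - q)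
  from-symm : (Σ ℕ λ n → σ ≈ (s₀ · t₀) ^ n ⊎ σ ≈ (t₀ · s₀) ^ n) → Generated s₀ t₀ (antisymm p q)
  from-symm (n , inj₁ e) = n , inj₂ (inj₂ (inj₁ (≈-trans (antisymm≈symm-·-s₀ p q) (·-congʳ s₀ e))))
  from-symm (zero , inj₂ e) = zero , inj₂ (inj₂ (inj₁ (≈-trans (antisymm≈symm-·-s₀ p q) (·-congʳ s₀ e))))
  from-symm (suc m , inj₂ e) = m , inj₂ (inj₂ (inj₂ (≈-trans (antisymm≈symm-·-s₀ p q)
    (≈-trans (·-congʳ s₀ e) (alternating-·-involution s₀ t₀ m s₀·s₀≈I)))))

Z-I-generated : ∀ τ → InZ I τ → Generated s₀ t₀ τ
Z-I-generated τ (hτ , τ⋆I≈I) = by-twist (≈⇒≡⊎≡neg (⋆I≈I⇒twist≈ τ hτ τ⋆I≈I))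
  where
  by-twist : twist τ ≡ τ ⊎ twist τ ≡ neg τ → Generated s₀ t₀ τ
  by-twist (inj₁ twistτ≡τ) =
    subst (Generated s₀ t₀) (sym τ≡symm) (Generated-symm (a τ) (b τ) (subst InΓ τ≡symm hτ))
    where
    τ≡symm : τ ≡ symm (a τ) (b τ)
    τ≡symm = mat-≡ refl refl (cong b twistτ≡τ) (cong a twistτ≡τ)
  by-twist (inj₂ twistτ≡-τ) =
    subst (Generated s₀ t₀) (sym τ≡antisymm) (Generated-antisymm (a τ) (b τ) (subst InΓ τ≡antisymm hτ))
    where
    τ≡antisymm : τ ≡ antisymm (a τ) (b τ)
    τ≡antisymm = mat-≡ refl refl (cong b twistτ≡-τ) (cong a twistτ≡-τ)

b≢0⇒≉I : ∀ x → b x ≢ + 0 → ¬ x ≈ I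
b≢0⇒≉I x b≢0 (inj₁ (_ , b≡0 , _))  = b≢0 b≡0
b≢0⇒≉I x b≢0 (inj₂ (_ , b≡-0 , _)) = b≢0 b≡-0

s₀t₀-infinite-order : ∀ n → ¬ ((s₀ · t₀) ^ suc n ≈ I)
s₀t₀-infinite-order n e =
  b≢0⇒≉I (symm (+ x) (- + y)) (-y≢0 (pell-snd-positive n)) (≈-trans (≈-sym power≈symm) e)
  where
  x = proj₁ (pell (suc n))
  y = proj₂ (pell (suc n))
  power≈symm : (s₀ · t₀) ^ suc n ≈ symm (+ x) (- + y)
  power≈symm = ≈-trans (^-cong (suc n) s₀t₀≈V) (≡⇒≈ (V-power (suc n)))
  -y≢0 : ∀ {y} → 0 < y → - + y ≢ + 0
  -y≢0 {suc _} _ ()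

Type4b-I : Type4b I
Type4b-I = s₀ , t₀ , (refl , ≡neg⇒≈ refl) , (refl , ≡neg⇒≈ refl) ,
           ((s₀·s₀≈I , b≢0⇒≉I s₀ λ ()) , (≡neg⇒≈ refl , b≢0⇒≉I t₀ λ ()) , s₀t₀-infinite-order) ,
           Z-I-generated , T⁺ , refl , ≡⇒≈ refl

proposition6p8 : (Σ Mat λ γ → InΓ γ × Admissible γ)
    × ((γ γ' : Mat) → InΓ γ → Admissible γ → InΓ γ' → Admissible γ' → TwistedConj γ γ')
    × ((γ : Mat) → InΓ γ → Admissible γ → Type4b γ)
proposition6p8 =
  (I , refl , ≈-refl) ,
  (λ γ γ' hγ aγ hγ' aγ' → TwistedConj-trans (Admissible⇒TwistedConj-I γ hγ aγ)
                                              (TwistedConj-sym (Admissible⇒TwistedConj-I γ' hγ' aγ'))) ,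
  (λ γ hγ aγ → Type4b-TwistedConj γ I (Admissible⇒TwistedConj-I γ hγ aγ) Type4b-I)
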